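{- For every positive integer $n$ there exists a non-trivial two-coloring $C$ of $\mathbb{Z}^d$ with $d = 2n^2 - n$ and $r(C) = n$; in particular $d = 2r(C)^2 - r(C)$.
   Context: A two-coloring $C$ of $\mathbb{Z}^d$ assigns to each lattice point one of two colors, red or blue. $C$ is non-trivial if the origin is red and, for each $i \in \{1,\dots,d\}$, there is at least one blue point on the $i$-th coordinate axis (a point all of whose coordinates other than the $i$-th are zero). For $x \in \mathbb{Z}^d$, the axis-sensitivity $r(C,x)$ is the number of indices $i \in \{1,\dots,d\}$ such that at least one of $x+e_i$, $x-e_i$ has a color different from that of $x$ ($e_i$ the $i$-th standard unit vector). The axis-sensitivity of $C$ is $r(C)=\max_{x\in\mathbb{Z}^d} r(C,x)$. -}

module Defs where

open import Data.Nat using (ℕ; _≤_; _*_; _∸_)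
open import Data.Integer using (ℤ; +_; _+_; _-_)
open import Data.Fin using (Fin; _≟_)
open import Data.Bool using (Bool; true; false; _∨_; not)
open import Data.List using (List; length; filter)
open import Data.List using () renaming (allFin to allFinL)
open import Data.Product using (_×_; ∃-syntax; Σ-syntax)
open import Relation.Binary.PropositionalEquality using (_≡_; _≢_)
open import Relation.Nullary.Decidable using (⌊_⌋; does)
open import Relation.Unary using (Pred)

data Color : Set where
  red blue : Color

color-eq : Color → Color → Bool
color-eq red  red  = true
color-eq blue blue = true
color-eq _    _    = false

Point : ℕ → Set
Point d = Fin d → ℤ

Coloring : ℕ → Set
Coloring d = Point d → Color

origin : ∀ {d} → Point d
origin _ = + 0

shift : ∀ {d} → Point d → Fin d → ℤ → Point d
shift x i k j with ⌊ i ≟ j ⌋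
... | true  = x j + k
... | false = x j

axisPoint : ∀ {d} → Fin d → ℤ → Point d
axisPoint i t j with ⌊ i ≟ j ⌋
... | true  = t
... | false = + 0

-- Non-trivial: origin red, and each coordinate axis contains a blue point.
-- (A point all of whose coordinates other than the i-th are zero is
-- exactly axisPoint i t for some t.)
NonTrivial : ∀ {d} → Coloring d → Set
NonTrivial {d} C =
  (C origin ≡ red) × ((i : Fin d) → ∃[ t ] (C (axisPoint i t) ≡ blue))

sensitiveAt : ∀ {d} → Coloring d → Point d → Fin d → Bool
sensitiveAt C x i =
  not (color-eq (C (shift x i (+ 1))) (C x)) ∨ not (color-eq (C (shift x i (Data.Integer.-_ (+ 1)))) (C x))

sensitivity : ∀ {d} → Coloring d → Point d → ℕ
sensitivity {d} C x = length (filter (λ i → sensitiveAt C x i Data.Bool.≟ true) (allFinL d))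

AxisSensitivityIs : ∀ {d} → Coloring d → ℕ → Set
AxisSensitivityIs {d} C n =
  ((x : Point d) → sensitivity C x ≤ n) × ∃[ x ] (sensitivity C x ≡ n)

module Submission where

-- Split the d = n(2n-1) coordinates into n blocks of 2k+1 = 2n-1 coordinates, each block
-- carrying the regular cyclic tournament in which a coordinate beats the k coordinates that
-- follow it cyclically. A point is blue iff it has a peak c: x c ≥ 3 while x ≤ 0 on the k
-- coordinates beaten by c. At a blue point only c and the coordinates it beats can be
-- sensitive, which is n directions. At a red point each sensitive direction leads to a blue
-- neighbour whose peak lies in the same block as that direction; two sensitive directions in
-- one block would yield peaks that either coincide (and then x has that peak too) or beat one
-- another (impossible, as one neighbour would have a coordinate ≥ 3 where the other has one
-- ≤ 0). So red points also have at most one sensitive direction per block, and the red point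
-- equal to 2 at the first coordinate of every block attains n.

open import Defs
open import Data.Nat as ℕ using (ℕ; zero; suc; _+_; _*_; _∸_; _≤_; _<_; s≤s)
import Data.Nat.Properties as ℕ
open import Data.Nat.DivMod using (_%_; _/_; _mod_; [m+n]%n≡m%n; m<n⇒m%n≡m; m≡m%n+[m/n]*n)
open import Data.Nat.Tactic.RingSolver using (solve-∀)
open import Data.Integer as ℤ using (ℤ; +_; -_; +≤+; -≤+)
import Data.Integer.Properties as ℤ
open import Data.Fin using (Fin; zero; suc; toℕ; fromℕ<; _≟_; remQuot; combine)
open import Data.Fin.Properties using (toℕ-injective; toℕ-fromℕ<; toℕ<n; <-cmp; any?; all?;
  injective⇒≤; remQuot-combine; combine-remQuot; combine-injectiveˡ)
open import Data.Bool using (true; _∨_; not; if_then_else_) renaming (_≟_ to _≟ᵇ_)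
open import Data.Bool.Properties using (∨-zeroʳ)
open import Data.List using (List; _∷_; length; lookup; filter) renaming (allFin to allFinL)
open import Data.List.Membership.Propositional using (_∈_)
open import Data.List.Membership.Propositional.Properties using (∈-lookup; ∈-filter⁺; ∈-filter⁻; ∈-allFin)
import Data.List.Relation.Unary.All as All
open import Data.List.Relation.Unary.AllPairs using (_∷_)
open import Data.List.Relation.Unary.Any using (index)
open import Data.List.Relation.Unary.Any.Properties using (lookup-index)
open import Data.List.Relation.Unary.Unique.Propositional using (Unique)
open import Data.List.Relation.Unary.Unique.Propositional.Properties using (allFin⁺)
  renaming (filter⁺ to Unique-filter⁺)
open import Data.Product using (_×_; _,_; proj₁; proj₂; map₂; ∃-syntax; Σ-syntax)
open import Data.Sum as Sum using (_⊎_; inj₁; inj₂)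
open import Data.Empty using (⊥-elim)
open import Function using (_∘_; case_of_)
open import Function.Definitions using (Injective)
open import Level using (0ℓ)
open import Relation.Binary using (tri<; tri≈; tri>)
open import Relation.Binary.PropositionalEquality
open import Relation.Nullary using (¬_; Dec; yes; no; does)
open import Relation.Nullary.Decidable using (_×-dec_; map′; decidable-stable)
open import Relation.Unary using (Pred; Decidable)

lookup-injective : ∀ {A : Set} {xs : List A} → Unique xs → Injective _≡_ _≡_ (lookup xs)
lookup-injective {xs = _ ∷ _}  (_ ∷ _)    {zero}  {zero}  _  = refl
lookup-injective {xs = _ ∷ xs} (x∉ ∷ _)   {zero}  {suc j} eq = ⊥-elim (All.lookup x∉ (∈-lookup {xs = xs} j) eq)
lookup-injective {xs = _ ∷ xs} (x∉ ∷ _)   {suc i} {zero}  eq = ⊥-elim (All.lookup x∉ (∈-lookup {xs = xs} i) (sym eq))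
lookup-injective {xs = _ ∷ _}  (_ ∷ uniq) {suc i} {suc j} eq = cong suc (lookup-injective uniq eq)

unique⇒length≤ : ∀ {A : Set} {xs : List A} {n} → Unique xs →
                 (f : ∀ {a} → a ∈ xs → Fin n) →
                 (∀ {a b} (a∈ : a ∈ xs) (b∈ : b ∈ xs) → f a∈ ≡ f b∈ → a ≡ b) →
                 length xs ≤ n
unique⇒length≤ {xs = xs} uniq f f-inj =
  injective⇒≤ (lookup-injective uniq ∘ f-inj (∈-lookup {xs = xs} _) (∈-lookup {xs = xs} _))

≤length : ∀ {A : Set} {xs : List A} {n} (g : Fin n → A) → Injective _≡_ _≡_ g →
          (∀ j → g j ∈ xs) → n ≤ length xs
≤length {xs = xs} g g-inj g∈ = injective⇒≤ λ {i} {j} eq → g-inj (begin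
  g i                      ≡⟨ lookup-index (g∈ i) ⟩
  lookup xs (index (g∈ i)) ≡⟨ cong (lookup xs) eq ⟩
  lookup xs (index (g∈ j)) ≡⟨ lookup-index (g∈ j) ⟨
  g j                      ∎)
  where open ≡-Reasoning

data Step : ℤ → Set where
  up   : Step (+ 1)
  down : Step (- + 1)

module _ {d : ℕ} (x : Point d) where

  shift-≡ : ∀ i t → shift x i t i ≡ x i ℤ.+ t
  shift-≡ i t with i ≟ i
  ... | yes _  = refl
  ... | no i≢i = ⊥-elim (i≢i refl)

  shift-≢ : ∀ i t j → i ≢ j → shift x i t j ≡ x j
  shift-≢ i t j i≢j with i ≟ j
  ... | yes i≡j = ⊥-elim (i≢j i≡j)
  ... | no _    = refl

  shift-≤ : ∀ i {s} → Step s → ∀ j → shift x i s j ℤ.≤ x j ℤ.+ + 1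
  shift-≤ i s j with i ≟ j
  shift-≤ i up   j | yes _ = ℤ.≤-refl
  shift-≤ i down j | yes _ = ℤ.+-monoʳ-≤ (x j) -≤+
  shift-≤ i s    j | no _  = ℤ.i≤i+j (x j) (+ 1)

  shift-≥ : ∀ i {s} → Step s → ∀ j → x j ℤ.≤ shift x i s j ℤ.+ + 1
  shift-≥ i s j with i ≟ j
  shift-≥ i up   j | yes _ = ℤ.≤-trans (ℤ.i≤i+j (x j) (+ 1)) (ℤ.i≤i+j (x j ℤ.+ + 1) (+ 1))
  shift-≥ i down j | yes _ = ℤ.≤-reflexive (sym (trans (ℤ.+-assoc (x j) (- + 1) (+ 1)) (ℤ.+-identityʳ (x j))))
  shift-≥ i s    j | no _  = ℤ.i≤i+j (x j) (+ 1)

  shift-shift-agree : ∀ {i₁ i₂} s₁ s₂ → i₁ ≢ i₂ → ∀ j →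
                      shift x i₁ s₁ j ≡ x j ⊎ shift x i₂ s₂ j ≡ x j
  shift-shift-agree {i₁} {i₂} s₁ s₂ i₁≢i₂ j = by-cases (i₁ ≟ j)
    where
    by-cases : Dec (i₁ ≡ j) → shift x i₁ s₁ j ≡ x j ⊎ shift x i₂ s₂ j ≡ x j
    by-cases (yes refl) = inj₂ (shift-≢ i₂ s₂ i₁ (i₁≢i₂ ∘ sym))
    by-cases (no i₁≢j)  = inj₁ (shift-≢ i₁ s₁ j i₁≢j)

axisPoint-≡ : ∀ {d} (i : Fin d) t → axisPoint i t i ≡ t
axisPoint-≡ i t with i ≟ i
... | yes _  = refl
... | no i≢i = ⊥-elim (i≢i refl)

axisPoint-≢ : ∀ {d} (i : Fin d) t j → i ≢ j → axisPoint i t j ≡ + 0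
axisPoint-≢ i t j i≢j with i ≟ j
... | yes i≡j = ⊥-elim (i≢j i≡j)
... | no _    = refl

≤0-two-steps : ∀ {a b c} → a ℤ.≤ + 0 → b ℤ.≤ a ℤ.+ + 1 → c ℤ.≤ b ℤ.+ + 1 → c ℤ.≤ + 2
≤0-two-steps {a} {b} {c} a≤0 b≤a+1 c≤b+1 = begin
  c                   ≤⟨ c≤b+1 ⟩
  b ℤ.+ + 1           ≤⟨ ℤ.+-monoˡ-≤ (+ 1) b≤a+1 ⟩
  a ℤ.+ + 1 ℤ.+ + 1   ≤⟨ ℤ.+-monoˡ-≤ (+ 1) (ℤ.+-monoˡ-≤ (+ 1) a≤0) ⟩
  + 2                 ∎
  where open ℤ.≤-Reasoning

not-color-eq : ∀ {a b} → a ≢ b → not (color-eq a b) ≡ true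
not-color-eq {red}  {red}  a≢b = ⊥-elim (a≢b refl)
not-color-eq {red}  {blue} _   = refl
not-color-eq {blue} {red}  _   = refl
not-color-eq {blue} {blue} a≢b = ⊥-elim (a≢b refl)

not-color-eq-∨ : ∀ a b c → (not (color-eq a c) ∨ not (color-eq b c)) ≡ true → a ≢ c ⊎ b ≢ c
not-color-eq-∨ red  _    blue _ = inj₁ λ ()
not-color-eq-∨ blue _    red  _ = inj₁ λ ()
not-color-eq-∨ red  blue red  _ = inj₂ λ ()
not-color-eq-∨ blue red  blue _ = inj₂ λ ()
not-color-eq-∨ red  red  red  ()
not-color-eq-∨ blue blue blue ()

module _ {d : ℕ} (C : Coloring d) (x : Point d) where

  sensitive⇒step : ∀ i → sensitiveAt C x i ≡ true → ∃[ s ] Step s × C (shift x i s) ≢ C x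
  sensitive⇒step i sens with not-color-eq-∨ (C (shift x i (+ 1))) (C (shift x i (- + 1))) (C x) sens
  ... | inj₁ differs = + 1 , up , differs
  ... | inj₂ differs = - + 1 , down , differs

  step⇒sensitive : ∀ i {s} → Step s → C (shift x i s) ≢ C x → sensitiveAt C x i ≡ true
  step⇒sensitive i up   differs rewrite not-color-eq differs = refl
  step⇒sensitive i down differs rewrite not-color-eq differs = ∨-zeroʳ _

  private
    Sensitive? : Decidable (λ i → sensitiveAt C x i ≡ true)
    Sensitive? i = sensitiveAt C x i ≟ᵇ true

  sensitivity≤ : ∀ {n} (f : ∀ i → sensitiveAt C x i ≡ true → Fin n) →
                 (∀ {i i′} si si′ → f i si ≡ f i′ si′ → i ≡ i′) →
                 sensitivity C x ≤ n
  sensitivity≤ f f-inj = unique⇒length≤ (Unique-filter⁺ Sensitive? (allFin⁺ d))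
    (λ {i} i∈ → f i (sensitive-member i∈)) (λ i∈ i′∈ → f-inj (sensitive-member i∈) (sensitive-member i′∈))
    where
    sensitive-member : ∀ {i} → i ∈ filter Sensitive? (allFinL d) → sensitiveAt C x i ≡ true
    sensitive-member = proj₂ ∘ ∈-filter⁻ Sensitive? {xs = allFinL d}

  ≤sensitivity : ∀ {n} (g : Fin n → Fin d) → Injective _≡_ _≡_ g →
                 (∀ j → sensitiveAt C x (g j) ≡ true) → n ≤ sensitivity C x
  ≤sensitivity g g-inj sens = ≤length g g-inj λ j → ∈-filter⁺ Sensitive? (∈-allFin (g j)) (sens j)

module _ {d : ℕ} {P : Pred (Point d) 0ℓ} (P? : Decidable P) where

  paint : Coloring d
  paint x = if does (P? x) then blue else red

  paint-blue : ∀ {x} → P x → paint x ≡ blue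
  paint-blue {x} px with P? x
  ... | yes _  = refl
  ... | no ¬px = ⊥-elim (¬px px)

  paint-red : ∀ {x} → ¬ P x → paint x ≡ red
  paint-red {x} ¬px with P? x
  ... | yes px = ⊥-elim (¬px px)
  ... | no _   = refl

  paint≢red : ∀ {x} → paint x ≢ red → P x
  paint≢red {x} ≢red with P? x
  ... | yes px = px
  ... | no _   = ⊥-elim (≢red refl)

_⊕_ : ∀ {m} → Fin (suc m) → ℕ → Fin (suc m)
_⊕_ {m} p j = (toℕ p + j) mod suc m

toℕ-⊕ : ∀ {m} (p : Fin (suc m)) j → toℕ (p ⊕ j) ≡ (toℕ p + j) % suc m
toℕ-⊕ p j = toℕ-fromℕ< _

⊕-identityʳ : ∀ {m} (p : Fin (suc m)) → p ⊕ 0 ≡ p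
⊕-identityʳ p = toℕ-injective (begin
  toℕ (p ⊕ 0)       ≡⟨ toℕ-⊕ p 0 ⟩
  (toℕ p + 0) % _   ≡⟨ cong (_% _) (ℕ.+-identityʳ (toℕ p)) ⟩
  toℕ p % _         ≡⟨ m<n⇒m%n≡m (toℕ<n p) ⟩
  toℕ p             ∎)
  where open ≡-Reasoning

wrap-around : ∀ k a e → suc a + (k + e) < suc (k + k) →
              ∃[ j ] j < k × suc a + (k + e) + suc j ≡ a + suc (k + k)
wrap-around k a e b<m with ℕ.m≤n⇒∃[o]m+o≡n e<k
  where
  e<k : e < k
  e<k = ℕ.+-cancelˡ-< k e k (ℕ.≤-<-trans (ℕ.m≤n+m (k + e) a) (ℕ.s<s⁻¹ b<m))
... | j , refl = j , s≤s (ℕ.m≤n+m j e) , arith a e j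
  where
  arith : ∀ a e j → let k = suc e + j in suc a + (k + e) + suc j ≡ a + suc (k + k)
  arith = solve-∀

cyclic-gap : ∀ k {a b} → a < b → b < suc (k + k) →
             (∃[ j ] j < k × a + suc j ≡ b) ⊎ (∃[ j ] j < k × b + suc j ≡ a + suc (k + k))
cyclic-gap k {a} a<b b<m with ℕ.m≤n⇒∃[o]m+o≡n a<b
... | δ , refl with δ ℕ.<? k
...   | yes δ<k = inj₁ (δ , δ<k , ℕ.+-suc a δ)
...   | no δ≮k with ℕ.m≤n⇒∃[o]m+o≡n (ℕ.≮⇒≥ δ≮k)
...     | e , refl = inj₂ (wrap-around k a e b<m)

module RegularTournament (k : ℕ) where

  m : ℕ
  m = suc (k + k)

  Position : Set
  Position = Fin m

  _⟶_ : Position → Position → Set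
  p ⟶ q = ∃[ j ] q ≡ p ⊕ suc (toℕ {k} j)

  toℕ-⊕-fromℕ< : ∀ p {j} (j<k : j < k) → toℕ (p ⊕ suc (toℕ (fromℕ< j<k))) ≡ (toℕ p + suc j) % m
  toℕ-⊕-fromℕ< p j<k = trans (toℕ-⊕ p _) (cong (λ t → (toℕ p + suc t) % m) (toℕ-fromℕ< j<k))

  ⟶-tournament-< : ∀ {p q} → toℕ p < toℕ q → p ⟶ q ⊎ q ⟶ p
  ⟶-tournament-< {p} {q} p<q with cyclic-gap k p<q (toℕ<n q)
  ... | inj₁ (j , j<k , p+j≡q) = inj₁ (fromℕ< j<k , toℕ-injective (sym (begin
    toℕ (p ⊕ suc (toℕ (fromℕ< j<k)))  ≡⟨ toℕ-⊕-fromℕ< p j<k ⟩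
    (toℕ p + suc j) % m               ≡⟨ cong (_% m) p+j≡q ⟩
    toℕ q % m                         ≡⟨ m<n⇒m%n≡m (toℕ<n q) ⟩
    toℕ q                             ∎)))
    where open ≡-Reasoning
  ... | inj₂ (j , j<k , q+j≡p+m) = inj₂ (fromℕ< j<k , toℕ-injective (sym (begin
    toℕ (q ⊕ suc (toℕ (fromℕ< j<k)))  ≡⟨ toℕ-⊕-fromℕ< q j<k ⟩
    (toℕ q + suc j) % m               ≡⟨ cong (_% m) q+j≡p+m ⟩
    (toℕ p + m) % m                   ≡⟨ [m+n]%n≡m%n (toℕ p) m ⟩
    toℕ p % m                         ≡⟨ m<n⇒m%n≡m (toℕ<n p) ⟩
    toℕ p                             ∎)))
    where open ≡-Reasoning

  ⟶-tournament : ∀ {p q} → p ≢ q → p ⟶ q ⊎ q ⟶ p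
  ⟶-tournament {p} {q} p≢q with <-cmp p q
  ... | tri< p<q _ _ = ⟶-tournament-< p<q
  ... | tri≈ _ p≡q _ = ⊥-elim (p≢q p≡q)
  ... | tri> _ _ q<p = Sum.swap (⟶-tournament-< q<p)

  ⟶-irreflexive : ∀ {p} → ¬ p ⟶ p
  ⟶-irreflexive {p} (j , p≡p⊕j) = steps≢multiple q (ℕ.+-cancelˡ-≡ (toℕ p) _ _ (begin
    toℕ p + suc (toℕ j)                    ≡⟨ m≡m%n+[m/n]*n (toℕ p + suc (toℕ j)) m ⟩
    (toℕ p + suc (toℕ j)) % m + q * m      ≡⟨ cong (_+ q * m) (trans (cong toℕ p≡p⊕j) (toℕ-⊕ p _)) ⟨
    toℕ p + q * m                          ∎))
    where
    open ≡-Reasoning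
    q : ℕ
    q = (toℕ p + suc (toℕ j)) / m
    steps≢multiple : ∀ q → suc (toℕ j) ≢ q * m
    steps≢multiple zero    ()
    steps≢multiple (suc q) eq = ℕ.<⇒≢ (ℕ.<-≤-trans (s≤s (ℕ.≤-trans (toℕ<n j) (ℕ.m≤m+n k k))) (ℕ.m≤m+n m (q * m))) eq

module Construction (k : ℕ) where

  open RegularTournament k

  n : ℕ
  n = suc k

  d : ℕ
  d = n * m

  opaque
    block : Fin d → Fin n
    block c = proj₁ (remQuot {n} m c)

    position : Fin d → Position
    position c = proj₂ (remQuot {n} m c)

    ahead : Fin d → ℕ → Fin d
    ahead c j = combine (block c) (position c ⊕ j)

    leader : Fin n → Fin d
    leader b = combine b zero

    block-ahead : ∀ c j → block (ahead c j) ≡ block c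
    block-ahead c j = cong proj₁ (remQuot-combine {k = m} (block c) (position c ⊕ j))

    position-ahead : ∀ c j → position (ahead c j) ≡ position c ⊕ j
    position-ahead c j = cong proj₂ (remQuot-combine {k = m} (block c) (position c ⊕ j))

    position-leader : ∀ b → position (leader b) ≡ zero
    position-leader b = cong proj₂ (remQuot-combine {k = m} b zero)

    leader-injective : Injective _≡_ _≡_ leader
    leader-injective {b} {b′} = combine-injectiveˡ b zero b′ zero

    block-position-injective : ∀ {c c′} → block c ≡ block c′ → position c ≡ position c′ → c ≡ c′
    block-position-injective {c} {c′} eq-block eq-pos =
      trans (sym (combine-remQuot {n} m c)) (trans (cong₂ combine eq-block eq-pos) (combine-remQuot {n} m c′))

    ahead-of-position : ∀ {c c′ j} → block c′ ≡ block c → position c′ ≡ position c ⊕ j → c′ ≡ ahead c j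
    ahead-of-position {c′ = c′} eq-block eq-pos =
      trans (sym (combine-remQuot {n} m c′)) (cong₂ combine eq-block eq-pos)

  ahead-zero : ∀ c → ahead c 0 ≡ c
  ahead-zero c = sym (ahead-of-position refl (sym (⊕-identityʳ (position c))))

  follower-position-≢ : ∀ c (j : Fin k) → position (ahead c (suc (toℕ j))) ≢ position c
  follower-position-≢ c j eq = ⟶-irreflexive (j , trans (sym eq) (position-ahead c _))

  follower-≢ : ∀ c (j : Fin k) → ahead c (suc (toℕ j)) ≢ c
  follower-≢ c j = follower-position-≢ c j ∘ cong position

  Follower : Fin d → Fin d → Set
  Follower c c′ = ∃[ j ] c′ ≡ ahead c (suc (toℕ {k} j))

  ahead-tournament : ∀ {c c′} → c ≢ c′ → block c ≡ block c′ → Follower c c′ ⊎ Follower c′ c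
  ahead-tournament {c} {c′} c≢c′ same-block =
    Sum.map (map₂ (ahead-of-position (sym same-block)))
            (map₂ (ahead-of-position same-block))
            (⟶-tournament (c≢c′ ∘ block-position-injective same-block))

  -- The gap between the thresholds 3 and 0 exceeds 2, the largest change of a coordinate
  -- between two neighbours of a point; this is what makes peaks of neighbours exclusive.
  record Peak (c : Fin d) (x : Point d) : Set where
    constructor mkPeak
    field
      high : + 3 ℤ.≤ x c
      low  : ∀ (j : Fin k) → x (ahead c (suc (toℕ j))) ℤ.≤ + 0

  Peak? : ∀ c x → Dec (Peak c x)
  Peak? c x = map′ (λ (h , l) → mkPeak h l) (λ (mkPeak h l) → h , l)
    ((+ 3 ℤ.≤? x c) ×-dec all? (λ j → x (ahead c (suc (toℕ j))) ℤ.≤? + 0))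

  Blue : Point d → Set
  Blue x = ∃[ c ] Peak c x

  Blue? : Decidable Blue
  Blue? x = any? (λ c → Peak? c x)

  coloring : Coloring d
  coloring = paint Blue?

  Window : Fin d → Fin d → Set
  Window c i = ∃[ j ] i ≡ ahead c (toℕ {n} j)

  window-block : ∀ {c i} → Window c i → block i ≡ block c
  window-block {c} (j , refl) = block-ahead c (toℕ j)

  peak-changes-in-window : ∀ {c i} {x y : Point d} → (∀ j → i ≢ j → y j ≡ x j) →
                           Peak c x → ¬ Peak c y → Window c i
  peak-changes-in-window {c} {i} {x} {y} agree (mkPeak x-high x-low) ¬peak
    with any? (λ j → i ≟ ahead c (toℕ {n} j))
  ... | yes in-window = in-window
  ... | no ∉window    = ⊥-elim (¬peak
          (mkPeak (subst (+ 3 ℤ.≤_) (sym (agree c i≢c)) x-high)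
                  (λ j → subst (ℤ._≤ + 0) (sym (agree _ (i≢follower j))) (x-low j))))
    where
    i≢c : i ≢ c
    i≢c i≡c = ∉window (zero , trans i≡c (sym (ahead-zero c)))
    i≢follower : ∀ (j : Fin k) → i ≢ ahead c (suc (toℕ j))
    i≢follower j eq = ∉window (suc j , eq)

  peak-of-agreeing : ∀ {c} {x y₁ y₂ : Point d} → (∀ j → y₁ j ≡ x j ⊎ y₂ j ≡ x j) →
                     Peak c y₁ → Peak c y₂ → Peak c x
  peak-of-agreeing {c} {x} {y₁} {y₂} agree (mkPeak high₁ low₁) (mkPeak high₂ low₂) =
    mkPeak (from-either (+ 3 ℤ.≤_) c high₁ high₂) (λ j → from-either (ℤ._≤ + 0) _ (low₁ j) (low₂ j))
    where
    from-either : ∀ (Q : ℤ → Set) j → Q (y₁ j) → Q (y₂ j) → Q (x j)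
    from-either Q j q₁ q₂ = Sum.[ (λ eq → subst Q eq q₁) , (λ eq → subst Q eq q₂) ]′ (agree j)

  sensitivity-at-peak : ∀ {c x} → Peak c x → sensitivity coloring x ≤ n
  sensitivity-at-peak {c} {x} peak = sensitivity≤ coloring x (λ i si → proj₁ (window i si))
    λ si si′ eq → trans (proj₂ (window _ si)) (trans (cong (ahead c ∘ toℕ) eq) (sym (proj₂ (window _ si′))))
    where
    window : ∀ i → sensitiveAt coloring x i ≡ true → Window c i
    window i si with sensitive⇒step coloring x i si
    ... | s , _ , differs = peak-changes-in-window (shift-≢ x i s) peak λ peak′ →
      differs (trans (paint-blue Blue? (c , peak′)) (sym (paint-blue Blue? (c , peak))))

  module _ {x : Point d} (¬blue : ¬ Blue x) where

    peak-beside-red : ∀ i → sensitiveAt coloring x i ≡ true →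
                      ∃[ s ] Step s × ∃[ c ] Peak c (shift x i s) × block i ≡ block c
    peak-beside-red i si with sensitive⇒step coloring x i si
    ... | s , step , differs with paint≢red Blue? (λ red → differs (trans red (sym (paint-red Blue? ¬blue))))
    ...   | c , peak = s , step , c , peak ,
            window-block {c} (peak-changes-in-window (λ j i≢j → sym (shift-≢ x i s j i≢j)) peak (¬blue ∘ (c ,_)))

    follower-peaks-beside-red : ∀ i₁ i₂ {s₁ s₂ c₁ c₂} → Step s₁ → Step s₂ →
                                Peak c₁ (shift x i₁ s₁) → Peak c₂ (shift x i₂ s₂) →
                                ¬ Follower c₁ c₂
    follower-peaks-beside-red i₁ i₂ step₁ step₂ (mkPeak _ low₁) (mkPeak high₂ _) (j , refl) =
      3≰2 (ℤ.≤-trans high₂ (≤0-two-steps (low₁ j) (shift-≥ x i₁ step₁ _) (shift-≤ x i₂ step₂ _)))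
      where
      3≰2 : ¬ (+ 3 ℤ.≤ + 2)
      3≰2 (+≤+ (s≤s (s≤s ())))

    peaks-beside-red-in-distinct-blocks : ∀ {i₁ i₂} s₁ s₂ {c₁ c₂} → i₁ ≢ i₂ → Step s₁ → Step s₂ →
                                          Peak c₁ (shift x i₁ s₁) → Peak c₂ (shift x i₂ s₂) →
                                          block c₁ ≢ block c₂
    peaks-beside-red-in-distinct-blocks {i₁} {i₂} s₁ s₂ {c₁} {c₂} i₁≢i₂ step₁ step₂ peak₁ peak₂ same-block
      with c₁ ≟ c₂
    ... | yes refl = ¬blue (c₁ , peak-of-agreeing (shift-shift-agree x s₁ s₂ i₁≢i₂) peak₁ peak₂)
    ... | no c₁≢c₂ = Sum.[ follower-peaks-beside-red i₁ i₂ step₁ step₂ peak₁ peak₂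
                         , follower-peaks-beside-red i₂ i₁ step₂ step₁ peak₂ peak₁ ]′
                       (ahead-tournament c₁≢c₂ same-block)

    sensitivity-at-red : sensitivity coloring x ≤ n
    sensitivity-at-red = sensitivity≤ coloring x (λ i _ → block i) block-injective
      where
      block-injective : ∀ {i i′} si si′ → block i ≡ block i′ → i ≡ i′
      block-injective {i} {i′} si si′ same-block = decidable-stable (i ≟ i′) λ i≢i′ →
        let s  , step  , c  , peak  , c-block  = peak-beside-red i si
            s′ , step′ , c′ , peak′ , c′-block = peak-beside-red i′ si′
        in peaks-beside-red-in-distinct-blocks s s′ i≢i′ step step′ peak peak′
             (trans (sym c-block) (trans same-block c′-block))

  sensitivity≤n : ∀ x → sensitivity coloring x ≤ n
  sensitivity≤n x with Blue? x
  ... | yes (c , peak) = sensitivity-at-peak peak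
  ... | no ¬blue       = sensitivity-at-red ¬blue

  -- Red, but one step from a peak at the first coordinate of every block.
  witness : Point d
  witness c = if does (position c ≟ zero) then + 2 else + 0

  witness-red : ¬ Blue witness
  witness-red (c , mkPeak _ _) with position c ≟ zero
  witness-red (c , mkPeak (+≤+ (s≤s (s≤s ()))) _) | yes _
  witness-red (c , mkPeak (+≤+ ()) _)             | no _

  peak-at-leader : ∀ b → Peak (leader b) (shift witness (leader b) (+ 1))
  peak-at-leader b = mkPeak (subst (+ 3 ℤ.≤_) (sym (shift-≡ witness (leader b) (+ 1))) leader-high) λ j →
    subst (ℤ._≤ + 0) (sym (trans (shift-≢ witness (leader b) (+ 1) _ (follower-≢ (leader b) j ∘ sym))
                                 (follower-low j)))
          ℤ.≤-refl
    where
    leader-high : + 3 ℤ.≤ witness (leader b) ℤ.+ + 1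
    leader-high rewrite position-leader b = ℤ.≤-refl
    follower-low : ∀ (j : Fin k) → witness (ahead (leader b) (suc (toℕ j))) ≡ + 0
    follower-low j with position (ahead (leader b) (suc (toℕ j))) ≟ zero
    ... | yes at-zero = ⊥-elim (follower-position-≢ (leader b) j (trans at-zero (sym (position-leader b))))
    ... | no _        = refl

  sensitive-at-leader : ∀ b → sensitiveAt coloring witness (leader b) ≡ true
  sensitive-at-leader b = step⇒sensitive coloring witness (leader b) up λ eq →
    case trans (sym (paint-blue Blue? (leader b , peak-at-leader b))) (trans eq (paint-red Blue? witness-red)) of λ ()

  sensitivity-witness : sensitivity coloring witness ≡ n
  sensitivity-witness = ℕ.≤-antisym (sensitivity≤n witness)
    (≤sensitivity coloring witness leader leader-injective sensitive-at-leader)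

  peak-on-axis : ∀ i → Peak i (axisPoint i (+ 3))
  peak-on-axis i = mkPeak (subst (+ 3 ℤ.≤_) (sym (axisPoint-≡ i (+ 3))) ℤ.≤-refl) λ j →
    subst (ℤ._≤ + 0) (sym (axisPoint-≢ i (+ 3) _ (follower-≢ i j ∘ sym))) ℤ.≤-refl

  nonTrivial : NonTrivial coloring
  nonTrivial = paint-red Blue? {origin} (λ { (_ , mkPeak (+≤+ ()) _) })
             , λ i → + 3 , paint-blue Blue? (i , peak-on-axis i)

dimension : ∀ k → 2 * suc k * suc k ∸ suc k ≡ suc k * suc (k + k)
dimension k = trans (cong (_∸ suc k) (expand k)) (ℕ.m+n∸n≡m (suc k * suc (k + k)) (suc k))
  where
  expand : ∀ k → 2 * suc k * suc k ≡ suc k * suc (k + k) + suc k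
  expand = solve-∀

theorem3 : (n : ℕ) → 1 ≤ n →
    Σ[ C ∈ Coloring (2 * n * n ∸ n) ] (NonTrivial C × AxisSensitivityIs C n)
theorem3 (suc k) _ rewrite dimension k =
  coloring , nonTrivial , sensitivity≤n , witness , sensitivity-witness
  where open Construction k
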